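{- Algorithm Find_Interesting is correct: given a graph $G$, it returns the answer "$G$ is a disjoint union of cliques" exactly when $G$ is a disjoint union of cliques, and otherwise it returns a set $T$ that is a maximal interesting set of $G$.
   Context: All graphs are finite and simple. For $X\subseteq V$, $C(X)$ denotes the set of vertices of $V\setminus X$ adjacent to every vertex of $X$; $N(u)$ is the neighbourhood of $u$. A set $X$ is co-connected if the complement of $G[X]$ is connected. A non-empty set $T\subseteq V$ is interesting if $T$ is co-connected and $G[C(T)]$ is not a clique (the empty set counts as a clique); it is maximal if not strictly contained in another interesting set. Algorithm Find_Interesting (input: graph $G=(V,E)$). Step 1: Compute the connected components of $G$. If every vertex has degree equal to the size of its component minus $1$, return "$G$ is a disjoint union of cliques" and stop. Otherwise take a vertex $u$ whose degree is strictly less than the size of its component minus $1$, perform a breadth-first search from $u$, let $v$ be any vertex at distance $2$ from $u$, and let $t$ be the parent of $v$ in the search. Step 2: Set $T:=\{t\}$, $C:=N(t)$, $U:=V\setminus(T\cup C)$, $Z:=\emptyset$. While there exists a vertex $u\in U$: if $N(u)\cap C$ is a clique, move $u$ from $U$ to $Z$; if $N(u)\cap C$ is not a clique, move $u$ from $U$ to $T$ and move every vertex of $C\setminus N(u)$ from $C$ to $U$. Finally return $T$. -}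

module Defs where

open import Data.Nat using (ℕ; _<_; _∸_)
open import Data.Bool using (Bool; true; false)
open import Data.Fin using (Fin)
open import Data.Fin.Subset using (Subset; _∈_; _∉_; _⊆_; ⁅_⁆; ∁; _∩_; _∪_; _─_; _-_; ∣_∣; Nonempty; Empty)
open import Data.Fin.Subset using () renaming (⊥ to ∅)
open import Data.Vec using (tabulate)
open import Data.Product using (Σ; _×_; ∃)
open import Relation.Nullary using (¬_)
open import Relation.Binary.PropositionalEquality using (_≡_; _≢_)
open import Relation.Binary.Construct.Closure.ReflexiveTransitive using (Star)
open import Function.Bundles using (_⇔_)

record Graph (n : ℕ) : Set where
  field
    E      : Fin n → Fin n → Bool
    sym    : ∀ x y → E x y ≡ E y x
    irrefl : ∀ x → E x x ≡ false

module _ {n : ℕ} (G : Graph n) where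
  open Graph G

  Adj : Fin n → Fin n → Set
  Adj x y = E x y ≡ true

  N : Fin n → Subset n
  N u = tabulate (E u)

  deg : Fin n → ℕ
  deg u = ∣ N u ∣

  Reach : Fin n → Fin n → Set
  Reach = Star Adj

  CompSize : Fin n → ℕ → Set
  CompSize u k = Σ (Subset n) λ S → (∀ x → (x ∈ S ⇔ Reach u x)) × ∣ S ∣ ≡ k

  DisjointUnionOfCliques : Set
  DisjointUnionOfCliques = ∀ x y → Reach x y → x ≢ y → Adj x y

  IsClique : (Fin n → Set) → Set
  IsClique P = ∀ x y → P x → P y → x ≢ y → Adj x y

  InC : Subset n → Fin n → Set
  InC X x = x ∉ X × (∀ y → y ∈ X → Adj x y)

  CoEdge : Subset n → Fin n → Fin n → Set
  CoEdge X x y = x ∈ X × y ∈ X × x ≢ y × ¬ Adj x y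

  CoConnected : Subset n → Set
  CoConnected X = ∀ x y → x ∈ X → y ∈ X → Star (CoEdge X) x y

  Interesting : Subset n → Set
  Interesting T = Nonempty T × CoConnected T × ¬ IsClique (InC T)

  MaximalInteresting : Subset n → Set
  MaximalInteresting T =
    Interesting T × (∀ T′ → Interesting T′ → T ⊆ T′ → T′ ⊆ T)

-- Algorithm Find_Interesting, modelled as a (nondeterministic) relation
-- between a graph and its possible outputs.

data Result (n : ℕ) : Set where
  unionOfCliques : Result n
  returnSet      : Subset n → Result n

record State (n : ℕ) : Set where
  constructor ⟨_,_,_,_⟩
  field
    T C U Z : Subset n

module _ {n : ℕ} (G : Graph n) where

  initState : Fin n → State n
  initState t = ⟨ ⁅ t ⁆ , N G t , ∁ (⁅ t ⁆ ∪ N G t) , ∅ ⟩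

  data LoopStep : State n → State n → Set where
    toZ : ∀ {T C U Z} u → u ∈ U →
          IsClique G (λ x → x ∈ (N G u ∩ C)) →
          LoopStep ⟨ T , C , U , Z ⟩ ⟨ T , C , U - u , Z ∪ ⁅ u ⁆ ⟩
    toT : ∀ {T C U Z} u → u ∈ U →
          ¬ IsClique G (λ x → x ∈ (N G u ∩ C)) →
          LoopStep ⟨ T , C , U , Z ⟩
                   ⟨ T ∪ ⁅ u ⁆ , C ∩ N G u , (U - u) ∪ (C ─ N G u) , Z ⟩

  data Run : Result n → Set where
    runCliques :
      (∀ u k → CompSize G u k → deg G u ≡ k ∸ 1) →
      Run unionOfCliques
    -- Step 1, second branch, then Step 2 run until U is empty.
    -- v is at distance 2 from u; t is a BFS parent of v, i.e. any common
    -- neighbour of u and v (every common neighbour is the BFS parent for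
    -- some order of exploring the neighbours).
    runLoop : ∀ u k v t s →
      CompSize G u k → deg G u < k ∸ 1 →
      u ≢ v → ¬ Adj G u v → Adj G u t → Adj G t v →
      Star LoopStep (initState t) s → Empty (State.U s) →
      Run (returnSet (State.T s))

  Correct : Result n → Set
  Correct r = (r ≡ unionOfCliques ⇔ DisjointUnionOfCliques G)
            × (∀ T → r ≡ returnSet T → MaximalInteresting G T)

{-# OPTIONS --safe #-}
-- Step 1 is right because G is a disjoint union of cliques iff it has no induced path
-- x – t – y, iff every closed neighbourhood N[u] is the whole component of u, i.e.
-- deg u = |component u| − 1.
-- Step 2 maintains: T is non-empty and co-connected, C = C(T) is not a clique, every
-- vertex of U has a non-neighbour in T, N(z) ∩ C is a clique for z ∈ Z, and T, C, U, Z
-- cover V. Each iteration removes a vertex from U ∪ C and adds none, so the loop stops.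
-- If then T ⊂ T′ with T′ interesting, a co-walk in T′ from T′ ∖ T into T leaves T′ ∖ T
-- at some z with a non-neighbour in T; so z ∉ T ∪ C ∪ U, hence z ∈ Z, and C(T′) ⊆ N(z) ∩ C
-- is a clique.
module Submission where

open import Defs
open import Data.Bool using (Bool; true) renaming (_≟_ to _≟ᵇ_)
open import Data.Empty using (⊥-elim)
open import Data.Fin using (Fin; zero; suc; _≟_)
open import Data.Fin.Properties using (any?; all?)
open import Data.Fin.Subset
  using (Subset; inside; outside; _∈_; _∉_; _⊆_; _⊂_; ⁅_⁆; ∁; _∩_; _∪_; _─_; _-_; ∣_∣; Nonempty; Empty)
open import Data.Fin.Subset using () renaming (⊥ to ∅)
open import Data.Fin.Subset.Properties
  using ( _∈?_; nonempty?; drop-∷-⊆; out⊂; out⊂in; in⊂in; ∪-identityʳ; p⊂q⇒∣p∣<∣q∣; ∣p∣≤n; ∉⊥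
        ; x∈⁅x⁆; x∈⁅y⁆⇒x≡y; ⊆-antisym; x∈p∩q⁺; x∈p∩q⁻; x∈p∪q⁺; x∈p∪q⁻; p─q⊆p; p∩q⊆p; ∩-comm
        ; x∈p∧x∉q⇒x∈p─q; x∈p∧x≢y⇒x∈p-y; x∈∁p⇒x∉p; x∉p⇒x∈∁p )
open import Data.Nat using (ℕ; zero; suc; _<_; _∸_; s≤s; z≤n)
open import Data.Nat.GeneralisedArithmetic using (fold)
open import Data.Nat.Induction using (<-wellFounded)
open import Data.Nat.Properties using (≤-<-trans; <-≤-trans; ∸-monoˡ-<; <⇒≢; n≮n)
open import Data.Product using (Σ; ∃; _×_; _,_; proj₁; proj₂)
open import Data.Sum using (_⊎_; inj₁; inj₂; [_,_]′)
import Data.Sum as Sum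
open import Data.Vec using (tabulate; []; _∷_; here; there)
open import Data.Vec.Properties using (lookup∘tabulate; []=⇒lookup; lookup⇒[]=)
open import Function using (_∘_; id; case_of_)
open import Function.Bundles using (_⇔_; mk⇔; Equivalence)
import Function.Properties.Equivalence as ⇔
open import Induction.WellFounded using (Acc; acc)
open import Level using (Level)
open import Relation.Binary using (Rel)
open import Relation.Binary.PropositionalEquality using (_≡_; _≢_; refl; sym; trans; cong; subst)
open import Relation.Binary.Construct.Closure.ReflexiveTransitive using (Star; ε; _◅_; _◅◅_)
import Relation.Binary.Construct.Closure.ReflexiveTransitive as Star
open import Relation.Nullary using (¬_; Dec; yes; no; does; contradiction)
open import Relation.Nullary.Decidable using (_×-dec_; _⊎-dec_; _→-dec_; ¬?; dec-true)
open import Relation.Unary using (Pred; Decidable)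

open Equivalence using (to; from)

private
  variable
    a ℓ : Level
    n : ℕ

∈-tabulate : (f : Fin n → Bool) {x : Fin n} → x ∈ tabulate f ⇔ f x ≡ true
∈-tabulate f {x} = mk⇔
  (λ x∈ → trans (sym (lookup∘tabulate f x)) ([]=⇒lookup x∈))
  (λ fx → lookup⇒[]= x (tabulate f) (trans (lookup∘tabulate f x) fx))

⟦_⟧ : {P : Pred (Fin n) ℓ} → Decidable P → Subset n
⟦ P? ⟧ = tabulate (does ∘ P?)

∈⟦⟧ : {P : Pred (Fin n) ℓ} (P? : Decidable P) {x : Fin n} → x ∈ ⟦ P? ⟧ ⇔ P x
∈⟦⟧ {P = P} P? {x} = mk⇔ sound (from (∈-tabulate (does ∘ P?)) ∘ dec-true (P? x))
  where
  sound : x ∈ ⟦ P? ⟧ → P x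
  sound x∈ with P? x | to (∈-tabulate (does ∘ P?) {x}) x∈
  ... | yes Px | _ = Px

x∈p─q⇒x∉q : {p q : Subset n} {x : Fin n} → x ∈ p ─ q → x ∉ q
x∈p─q⇒x∉q {p = _ ∷ p} {inside  ∷ q} (there x∈) (there x∈q) = x∈p─q⇒x∉q x∈ x∈q
x∈p─q⇒x∉q {p = _ ∷ p} {outside ∷ q} (there x∈) (there x∈q) = x∈p─q⇒x∉q x∈ x∈q

x∈p∪⁅y⁆⁻ : {p : Subset n} {x y : Fin n} → x ∈ p ∪ ⁅ y ⁆ → x ∈ p ⊎ x ≡ y
x∈p∪⁅y⁆⁻ {p = p} {y = y} = Sum.map₂ (x∈⁅y⁆⇒x≡y y) ∘ x∈p∪q⁻ p ⁅ y ⁆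

x∉p⇒∣p∪⁅x⁆∣≡1+∣p∣ : {p : Subset n} {x : Fin n} → x ∉ p → ∣ p ∪ ⁅ x ⁆ ∣ ≡ suc ∣ p ∣
x∉p⇒∣p∪⁅x⁆∣≡1+∣p∣ {p = outside ∷ p} {zero}  _   = cong suc (cong ∣_∣ (∪-identityʳ p))
x∉p⇒∣p∪⁅x⁆∣≡1+∣p∣ {p = inside  ∷ p} {zero}  x∉p = contradiction here x∉p
x∉p⇒∣p∪⁅x⁆∣≡1+∣p∣ {p = outside ∷ p} {suc x} x∉p = x∉p⇒∣p∪⁅x⁆∣≡1+∣p∣ (x∉p ∘ there)
x∉p⇒∣p∪⁅x⁆∣≡1+∣p∣ {p = inside  ∷ p} {suc x} x∉p = cong suc (x∉p⇒∣p∪⁅x⁆∣≡1+∣p∣ (x∉p ∘ there))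

p⊆q⇒p≡q⊎p⊂q : {p q : Subset n} → p ⊆ q → p ≡ q ⊎ p ⊂ q
p⊆q⇒p≡q⊎p⊂q {p = []}          {[]}          _   = inj₁ refl
p⊆q⇒p≡q⊎p⊂q {p = outside ∷ p} {outside ∷ q} p⊆q =
  Sum.map (cong (outside ∷_)) out⊂ (p⊆q⇒p≡q⊎p⊂q (drop-∷-⊆ p⊆q))
p⊆q⇒p≡q⊎p⊂q {p = inside  ∷ p} {inside  ∷ q} p⊆q =
  Sum.map (cong (inside ∷_)) in⊂in (p⊆q⇒p≡q⊎p⊂q (drop-∷-⊆ p⊆q))
p⊆q⇒p≡q⊎p⊂q {p = outside ∷ p} {inside  ∷ q} p⊆q = inj₂ (out⊂in (drop-∷-⊆ p⊆q))
p⊆q⇒p≡q⊎p⊂q {p = inside  ∷ p} {outside ∷ q} p⊆q = case p⊆q here of λ ()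

-- A strictly growing chain of subsets of Fin n has length at most n.
module _ {F : Subset n → Subset n} (inflationary : ∀ S → S ⊆ F S) where

  ⊆-fold : ∀ S k → S ⊆ fold S F k
  ⊆-fold S zero    = id
  ⊆-fold S (suc k) = inflationary (fold S F k) ∘ ⊆-fold S k

  stable⊎growing : ∀ S → F S ≡ S ⊎ ∣ S ∣ < ∣ F S ∣
  stable⊎growing S = Sum.map sym p⊂q⇒∣p∣<∣q∣ (p⊆q⇒p≡q⊎p⊂q (inflationary S))

  fold-stable⊎growing : ∀ S k → F (fold S F k) ≡ fold S F k ⊎ k < ∣ fold S F (suc k) ∣
  fold-stable⊎growing S zero = Sum.map₂ (≤-<-trans z≤n) (stable⊎growing S)
  fold-stable⊎growing S (suc k) with fold-stable⊎growing S k
  ... | inj₁ eq = inj₁ (cong F eq)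
  ... | inj₂ k< = Sum.map₂ (≤-<-trans k<) (stable⊎growing (fold S F (suc k)))

  fold-fixpoint : ∀ S → F (fold S F n) ≡ fold S F n
  fold-fixpoint S with fold-stable⊎growing S n
  ... | inj₁ eq = eq
  ... | inj₂ n< = contradiction (<-≤-trans n< (∣p∣≤n (fold S F (suc n)))) (n≮n n)

module _ {S : Set a} {R : Rel S ℓ} where

  preserved : {P : Pred S ℓ} → (∀ {s s′} → R s s′ → P s → P s′) → ∀ {s s′} → Star R s s′ → P s → P s′
  preserved {P} step = Star.fold (λ s s′ → P s → P s′) (λ r f → f ∘ step r) id

  halts : {P Q : Pred S ℓ} (μ : S → ℕ) → (∀ {s s′} → R s s′ → P s → P s′) →
          (∀ s → P s → Q s ⊎ ∃ λ s′ → R s s′ × μ s′ < μ s) →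
          ∀ s → P s → ∃ λ s′ → Star R s s′ × Q s′
  halts {P} {Q} μ step progress s Ps = go s Ps (<-wellFounded (μ s))
    where
    go : ∀ s → P s → Acc _<_ (μ s) → ∃ λ s′ → Star R s s′ × Q s′
    go s Ps (acc rs) with progress s Ps
    ... | inj₁ Qs              = s , ε , Qs
    ... | inj₂ (s′ , r , μ<) with go s′ (step r Ps) (rs μ<)
    ...   | s″ , run , Qs″ = s″ , r ◅ run , Qs″

module _ {n : ℕ} (G : Graph n) where

  open Graph G using (E)

  private
    variable
      t u w x y z : Fin n
      k : ℕ
      S T C U Z T′ : Subset n

  infix 4 _~_ _≁_ _~?_

  _~_ _≁_ : Fin n → Fin n → Set
  x ~ y = Adj G x y
  x ≁ y = ¬ x ~ y

  _~?_ : ∀ x y → Dec (x ~ y)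
  x ~? y = E x y ≟ᵇ true

  ~-sym : x ~ y → y ~ x
  ~-sym {x} {y} = trans (Graph.sym G y x)

  ~-irrefl : x ≁ x
  ~-irrefl {x} x~x = case trans (sym x~x) (Graph.irrefl G x) of λ ()

  ∈N⇔~ : y ∈ N G x ⇔ x ~ y
  ∈N⇔~ {x = x} = ∈-tabulate (E x)

  x∉N[x] : x ∉ N G x
  x∉N[x] = ~-irrefl ∘ to ∈N⇔~

  isClique? : ∀ S → Dec (IsClique G (_∈ S))
  isClique? S = all? λ x → all? λ y →
    x ∈? S →-dec y ∈? S →-dec ¬? (x ≟ y) →-dec x ~? y

  IsClique-mono : {P Q : Fin n → Set} → (∀ {x} → Q x → P x) → IsClique G P → IsClique G Q
  IsClique-mono Q⊆P P-clique x y Qx Qy x≢y = P-clique x y (Q⊆P Qx) (Q⊆P Qy) x≢y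

  -- Connected components

  expand? : ∀ S x → Dec (x ∈ S ⊎ ∃ λ y → y ∈ S × y ~ x)
  expand? S x = x ∈? S ⊎-dec any? λ y → y ∈? S ×-dec y ~? x

  expand : Subset n → Subset n
  expand S = ⟦ expand? S ⟧

  ⊆-expand : ∀ S → S ⊆ expand S
  ⊆-expand S x∈S = from (∈⟦⟧ (expand? _)) (inj₁ x∈S)

  component : Fin n → Subset n
  component u = fold ⁅ u ⁆ expand n

  component-sound : ∀ k → x ∈ fold ⁅ u ⁆ expand k → Reach G u x
  component-sound {u = u} zero x∈ with x∈⁅y⁆⇒x≡y u x∈
  ... | refl = ε
  component-sound (suc k) x∈ with to (∈⟦⟧ (expand? _)) x∈
  ... | inj₁ x∈′           = component-sound k x∈′
  ... | inj₂ (y , y∈ , y~x) = component-sound k y∈ ◅◅ (y~x ◅ ε)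

  component-closed : y ∈ component u → y ~ x → x ∈ component u
  component-closed {u = u} y∈ y~x =
    subst (_ ∈_) (fold-fixpoint ⊆-expand ⁅ u ⁆) (from (∈⟦⟧ (expand? _)) (inj₂ (_ , y∈ , y~x)))

  component-complete : Reach G u x → x ∈ component u
  component-complete {u} = go (⊆-fold ⊆-expand ⁅ u ⁆ n (x∈⁅x⁆ u))
    where
    go : ∀ {a b} → a ∈ component u → Reach G a b → b ∈ component u
    go a∈ ε             = a∈
    go a∈ (a~c ◅ c→b) = go (component-closed a∈ a~c) c→b

  componentSize : ∀ u → CompSize G u ∣ component u ∣
  componentSize u = component u , (λ x → mk⇔ (component-sound n) component-complete) , refl

  -- Degrees against component sizes

  N[_] : Fin n → Subset n
  N[ u ] = N G u ∪ ⁅ u ⁆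

  ∣N[u]∣≡1+deg : ∣ N[ u ] ∣ ≡ suc (deg G u)
  ∣N[u]∣≡1+deg = x∉p⇒∣p∪⁅x⁆∣≡1+∣p∣ x∉N[x]

  N[u]⊆component : (∀ x → x ∈ S ⇔ Reach G u x) → N[ u ] ⊆ S
  N[u]⊆component S⇔ x∈ with x∈p∪⁅y⁆⁻ x∈
  ... | inj₁ x∈N = from (S⇔ _) (to ∈N⇔~ x∈N ◅ ε)
  ... | inj₂ refl = from (S⇔ _) ε

  deg<size∸1 : CompSize G u k → Reach G u y → u ≢ y → u ≁ y → deg G u < k ∸ 1
  deg<size∸1 {u} {y = y} (S , S⇔ , refl) u→y u≢y u≁y =
    ∸-monoˡ-< (subst (_< ∣ S ∣) ∣N[u]∣≡1+deg N[u]⊂S) (s≤s z≤n)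
    where
    y∉N[u] : y ∉ N[ u ]
    y∉N[u] y∈ = [ u≁y ∘ to ∈N⇔~ , u≢y ∘ sym ]′ (x∈p∪⁅y⁆⁻ y∈)

    N[u]⊂S : ∣ N[ u ] ∣ < ∣ S ∣
    N[u]⊂S = p⊂q⇒∣p∣<∣q∣ (N[u]⊆component S⇔ , y , from (S⇔ y) u→y , y∉N[u])

  DUC⇒deg≡size∸1 : DisjointUnionOfCliques G → ∀ u k → CompSize G u k → deg G u ≡ k ∸ 1
  DUC⇒deg≡size∸1 duc u _ (S , S⇔ , refl) = cong (_∸ 1) (begin
    suc (deg G u)  ≡⟨ ∣N[u]∣≡1+deg ⟨
    ∣ N[ u ] ∣     ≡⟨ cong ∣_∣ (⊆-antisym (N[u]⊆component S⇔) S⊆N[u]) ⟩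
    ∣ S ∣          ∎)
    where
    open Relation.Binary.PropositionalEquality.≡-Reasoning
    S⊆N[u] : S ⊆ N[ u ]
    S⊆N[u] {x} x∈S with x ≟ u
    ... | yes refl = x∈p∪q⁺ (inj₂ (x∈⁅x⁆ x))
    ... | no x≢u   = x∈p∪q⁺ (inj₁ (from ∈N⇔~ (duc u x (to (S⇔ x) x∈S) (x≢u ∘ sym))))

  deg≡size∸1⇒DUC : (∀ u k → CompSize G u k → deg G u ≡ k ∸ 1) → DisjointUnionOfCliques G
  deg≡size∸1⇒DUC deg≡ x y x→y x≢y with x ~? y
  ... | yes x~y = x~y
  ... | no  x≁y = contradiction (deg≡ x _ (componentSize x))
                    (<⇒≢ (deg<size∸1 (componentSize x) x→y x≢y x≁y))

  InducedP₃ : Fin n → Fin n → Fin n → Set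
  InducedP₃ x t y = x ≢ y × x ≁ y × x ~ t × t ~ y

  HasInducedP₃ : Set
  HasInducedP₃ = ∃ λ x → ∃ λ t → ∃ λ y → InducedP₃ x t y

  hasInducedP₃? : Dec HasInducedP₃
  hasInducedP₃? = any? λ x → any? λ t → any? λ y →
    ¬? (x ≟ y) ×-dec ¬? (x ~? y) ×-dec x ~? t ×-dec t ~? y

  ¬HasInducedP₃⇒DUC : ¬ HasInducedP₃ → DisjointUnionOfCliques G
  ¬HasInducedP₃⇒DUC noP₃ x y x→y x≢y = [ ⊥-elim ∘ x≢y , id ]′ (≡⊎~ x→y)
    where
    ≡⊎~ : ∀ {a b} → Reach G a b → a ≡ b ⊎ a ~ b
    ≡⊎~ ε = inj₁ refl
    ≡⊎~ {a} {b} (a~c ◅ c→b) with ≡⊎~ c→b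
    ... | inj₁ refl = inj₂ a~c
    ... | inj₂ c~b with a ≟ b | a ~? b
    ...   | yes a≡b | _       = inj₁ a≡b
    ...   | no _    | yes a~b = inj₂ a~b
    ...   | no a≢b  | no a≁b  = contradiction (a , _ , b , a≢b , a≁b , a~c , c~b) noP₃

  -- C(T) and co-connectivity

  InC-antitone : T ⊆ T′ → InC G T′ x → InC G T x
  InC-antitone T⊆T′ (x∉T′ , x~T′) = x∉T′ ∘ T⊆T′ , λ y → x~T′ y ∘ T⊆T′

  InC-⁅⁆ : InC G ⁅ t ⁆ x ⇔ t ~ x
  InC-⁅⁆ {t} {x} = mk⇔
    (λ (_ , x~t) → ~-sym (x~t t (x∈⁅x⁆ t)))
    (λ t~x → (λ x∈ → ~-irrefl (subst (t ~_) (x∈⁅y⁆⇒x≡y t x∈) t~x))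
           , λ y y∈ → subst (x ~_) (sym (x∈⁅y⁆⇒x≡y t y∈)) (~-sym t~x))

  InC-∪⁅⁆ : InC G (T ∪ ⁅ u ⁆) x ⇔ (InC G T x × x ~ u)
  InC-∪⁅⁆ {T} {u} {x} = mk⇔
    (λ (x∉ , x~) → (x∉ ∘ x∈p∪q⁺ ∘ inj₁ , λ y → x~ y ∘ x∈p∪q⁺ ∘ inj₁) , x~ u (x∈p∪q⁺ (inj₂ (x∈⁅x⁆ u))))
    (λ ((x∉T , x~T) , x~u) →
        (λ x∈ → [ x∉T , (λ { refl → ~-irrefl x~u }) ]′ (x∈p∪⁅y⁆⁻ x∈))
      , λ y y∈ → [ x~T y , (λ { refl → x~u }) ]′ (x∈p∪⁅y⁆⁻ y∈))

  CoEdge-mono : S ⊆ T → CoEdge G S x y → CoEdge G T x y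
  CoEdge-mono S⊆T (x∈ , y∈ , x≢y , x≁y) = S⊆T x∈ , S⊆T y∈ , x≢y , x≁y

  CoEdge-sym : CoEdge G S x y → CoEdge G S y x
  CoEdge-sym (x∈ , y∈ , x≢y , x≁y) = y∈ , x∈ , x≢y ∘ sym , x≁y ∘ ~-sym

  coConnected-⁅⁆ : CoConnected G ⁅ t ⁆
  coConnected-⁅⁆ {t} x y x∈ y∈ with x∈⁅y⁆⇒x≡y t x∈ | x∈⁅y⁆⇒x≡y t y∈
  ... | refl | refl = ε

  coConnected-∪⁅⁆ : CoConnected G T → w ∈ T → u ≢ w → u ≁ w → CoConnected G (T ∪ ⁅ u ⁆)
  coConnected-∪⁅⁆ {T} {w} {u} T-cc w∈T u≢w u≁w x y x∈ y∈ = walk (x∈p∪⁅y⁆⁻ x∈) (x∈p∪⁅y⁆⁻ y∈)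
    where
    lift : ∀ {a b} → Star (CoEdge G T) a b → Star (CoEdge G (T ∪ ⁅ u ⁆)) a b
    lift = Star.map (CoEdge-mono (x∈p∪q⁺ ∘ inj₁))

    u—w : CoEdge G (T ∪ ⁅ u ⁆) u w
    u—w = x∈p∪q⁺ (inj₂ (x∈⁅x⁆ u)) , x∈p∪q⁺ (inj₁ w∈T) , u≢w , u≁w

    walk : ∀ {a b} → a ∈ T ⊎ a ≡ u → b ∈ T ⊎ b ≡ u → Star (CoEdge G (T ∪ ⁅ u ⁆)) a b
    walk (inj₁ a∈T) (inj₁ b∈T) = lift (T-cc _ _ a∈T b∈T)
    walk (inj₁ a∈T) (inj₂ refl) = lift (T-cc _ w a∈T w∈T) ◅◅ (CoEdge-sym u—w ◅ ε)
    walk (inj₂ refl) (inj₁ b∈T) = u—w ◅ lift (T-cc w _ w∈T b∈T)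
    walk (inj₂ refl) (inj₂ refl) = ε

  coWalk-leaves : x ∉ T → y ∈ T → Star (CoEdge G S) x y →
                  ∃ λ z → z ∈ S × z ∉ T × ∃ λ w → w ∈ T × z ≁ w
  coWalk-leaves x∉T y∈T ε = contradiction y∈T x∉T
  coWalk-leaves {T = T} x∉T y∈T (_◅_ {j = z} (x∈S , _ , _ , x≁z) walk) with z ∈? T
  ... | yes z∈T = _ , x∈S , x∉T , z , z∈T , x≁z
  ... | no  z∉T = coWalk-leaves z∉T y∈T walk

  -- The loop of Step 2

  record Invariant (T C U Z : Subset n) : Set where
    field
      T-nonempty    : Nonempty T
      T-coConnected : CoConnected G T
      C⇔InC         : x ∈ C ⇔ InC G T x
      C-nonClique   : ¬ IsClique G (_∈ C)
      U-misses-T    : x ∈ U → x ∉ T × ∃ λ w → w ∈ T × x ≁ w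
      Z-cliques     : z ∈ Z → IsClique G (_∈ N G z ∩ C)
      covers        : ∀ x → x ∈ T ⊎ x ∈ C ⊎ x ∈ U ⊎ x ∈ Z

    U-disjoint-C : x ∈ U → x ∉ C
    U-disjoint-C x∈U x∈C with U-misses-T x∈U
    ... | _ , w , w∈T , x≁w = x≁w (proj₂ (to C⇔InC x∈C) w w∈T)

  Inv : State n → Set
  Inv ⟨ T , C , U , Z ⟩ = Invariant T C U Z

  invariant-init : x ~ t → t ~ y → x ≢ y → x ≁ y → Inv (initState G t)
  invariant-init {x} {t} {y} x~t t~y x≢y x≁y = record
    { T-nonempty    = t , x∈⁅x⁆ t
    ; T-coConnected = coConnected-⁅⁆
    ; C⇔InC         = ⇔.trans ∈N⇔~ (⇔.sym InC-⁅⁆)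
    ; C-nonClique   = λ cl → x≁y (cl x y (from ∈N⇔~ (~-sym x~t)) (from ∈N⇔~ t~y) x≢y)
    ; U-misses-T    = U-misses-t ∘ x∈∁p⇒x∉p
    ; Z-cliques     = λ z∈∅ → contradiction z∈∅ ∉⊥
    ; covers        = covers
    }
    where
    U-misses-t : z ∉ ⁅ t ⁆ ∪ N G t → z ∉ ⁅ t ⁆ × ∃ λ w → w ∈ ⁅ t ⁆ × z ≁ w
    U-misses-t z∉ = z∉ ∘ x∈p∪q⁺ ∘ inj₁ , t , x∈⁅x⁆ t , z∉ ∘ x∈p∪q⁺ ∘ inj₂ ∘ from ∈N⇔~ ∘ ~-sym

    covers : ∀ z → z ∈ ⁅ t ⁆ ⊎ z ∈ N G t ⊎ z ∈ ∁ (⁅ t ⁆ ∪ N G t) ⊎ z ∈ ∅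
    covers z with z ∈? ⁅ t ⁆ ∪ N G t
    ... | yes z∈ = [ inj₁ , inj₂ ∘ inj₁ ]′ (x∈p∪q⁻ _ _ z∈)
    ... | no  z∉ = inj₂ (inj₂ (inj₁ (x∉p⇒x∈∁p z∉)))

  invariant-toZ : u ∈ U → IsClique G (_∈ N G u ∩ C) →
                  Invariant T C U Z → Invariant T C (U - u) (Z ∪ ⁅ u ⁆)
  invariant-toZ {u} {U} {C} {T} {Z} u∈U u-clique I = record
    { T-nonempty    = T-nonempty
    ; T-coConnected = T-coConnected
    ; C⇔InC         = C⇔InC
    ; C-nonClique   = C-nonClique
    ; U-misses-T    = U-misses-T ∘ p─q⊆p U ⁅ u ⁆
    ; Z-cliques     = λ z∈ → [ Z-cliques , (λ { refl → u-clique }) ]′ (x∈p∪⁅y⁆⁻ z∈)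
    ; covers        = covers′
    }
    where
    open Invariant I
    covers′ : ∀ x → x ∈ T ⊎ x ∈ C ⊎ x ∈ U - u ⊎ x ∈ Z ∪ ⁅ u ⁆
    covers′ x with covers x | x ≟ u
    ... | inj₂ (inj₂ (inj₁ _))   | yes refl = inj₂ (inj₂ (inj₂ (x∈p∪q⁺ (inj₂ (x∈⁅x⁆ x)))))
    ... | inj₂ (inj₂ (inj₁ x∈U)) | no x≢u   = inj₂ (inj₂ (inj₁ (x∈p∧x≢y⇒x∈p-y x∈U x≢u)))
    ... | inj₂ (inj₂ (inj₂ x∈Z)) | _        = inj₂ (inj₂ (inj₂ (x∈p∪q⁺ (inj₁ x∈Z))))
    ... | inj₁ x∈T               | _        = inj₁ x∈T
    ... | inj₂ (inj₁ x∈C)        | _        = inj₂ (inj₁ x∈C)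

  invariant-toT : u ∈ U → ¬ IsClique G (_∈ N G u ∩ C) → Invariant T C U Z →
                  Invariant (T ∪ ⁅ u ⁆) (C ∩ N G u) ((U - u) ∪ (C ─ N G u)) Z
  invariant-toT {u} {U} {C} {T} {Z} u∈U u-nonClique I with Invariant.U-misses-T I u∈U
  ... | u∉T , w , w∈T , u≁w = record
    { T-nonempty    = proj₁ T-nonempty , x∈p∪q⁺ (inj₁ (proj₂ T-nonempty))
    ; T-coConnected = coConnected-∪⁅⁆ T-coConnected w∈T (λ { refl → u∉T w∈T }) u≁w
    ; C⇔InC         = ⇔.trans C∩N⇔ (⇔.sym InC-∪⁅⁆)
    ; C-nonClique   = u-nonClique ∘ IsClique-mono (subst (_ ∈_) (∩-comm (N G u) C))
    ; U-misses-T    = [ U-misses-T′ , C─N-misses-u ]′ ∘ x∈p∪q⁻ _ _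
    ; Z-cliques     = IsClique-mono N∩C∩N⊆N∩C ∘ Z-cliques
    ; covers        = covers′
    }
    where
    open Invariant I

    N∩C∩N⊆N∩C : x ∈ N G z ∩ (C ∩ N G u) → x ∈ N G z ∩ C
    N∩C∩N⊆N∩C x∈ = let x∈N , x∈C∩N = x∈p∩q⁻ _ _ x∈ in x∈p∩q⁺ (x∈N , p∩q⊆p C (N G u) x∈C∩N)

    ∉T∪⁅u⁆ : x ∉ T → x ≢ u → x ∉ T ∪ ⁅ u ⁆
    ∉T∪⁅u⁆ x∉T x≢u = [ x∉T , x≢u ]′ ∘ x∈p∪⁅y⁆⁻

    C∩N⇔ : x ∈ C ∩ N G u ⇔ (InC G T x × x ~ u)
    C∩N⇔ = mk⇔
      (λ x∈ → let x∈C , x∈N = x∈p∩q⁻ _ _ x∈ in to C⇔InC x∈C , ~-sym (to ∈N⇔~ x∈N))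
      (λ (x∈C[T] , x~u) → x∈p∩q⁺ (from C⇔InC x∈C[T] , from ∈N⇔~ (~-sym x~u)))

    U-misses-T′ : x ∈ U - u → x ∉ T ∪ ⁅ u ⁆ × ∃ λ w → w ∈ T ∪ ⁅ u ⁆ × x ≁ w
    U-misses-T′ x∈ with U-misses-T (p─q⊆p U ⁅ u ⁆ x∈)
    ... | x∉T , w , w∈T , x≁w =
      ∉T∪⁅u⁆ x∉T (λ { refl → x∈p─q⇒x∉q x∈ (x∈⁅x⁆ u) }) , w , x∈p∪q⁺ (inj₁ w∈T) , x≁w

    C─N-misses-u : x ∈ C ─ N G u → x ∉ T ∪ ⁅ u ⁆ × ∃ λ w → w ∈ T ∪ ⁅ u ⁆ × x ≁ w
    C─N-misses-u {x} x∈ =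
      ∉T∪⁅u⁆ (proj₁ (to C⇔InC x∈C)) (λ { refl → U-disjoint-C u∈U x∈C })
      , u , x∈p∪q⁺ (inj₂ (x∈⁅x⁆ u)) , x∈p─q⇒x∉q x∈ ∘ from ∈N⇔~ ∘ ~-sym
      where
      x∈C : x ∈ C
      x∈C = p─q⊆p C (N G u) x∈

    covers′ : ∀ x → x ∈ T ∪ ⁅ u ⁆ ⊎ x ∈ C ∩ N G u ⊎ x ∈ (U - u) ∪ (C ─ N G u) ⊎ x ∈ Z
    covers′ x with covers x
    ... | inj₁ x∈T               = inj₁ (x∈p∪q⁺ (inj₁ x∈T))
    ... | inj₂ (inj₂ (inj₂ x∈Z)) = inj₂ (inj₂ (inj₂ x∈Z))
    ... | inj₂ (inj₁ x∈C) with x ∈? N G u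
    ...   | yes x∈N = inj₂ (inj₁ (x∈p∩q⁺ (x∈C , x∈N)))
    ...   | no  x∉N = inj₂ (inj₂ (inj₁ (x∈p∪q⁺ (inj₂ (x∈p∧x∉q⇒x∈p─q x∈C x∉N)))))
    covers′ x | inj₂ (inj₂ (inj₁ x∈U)) with x ≟ u
    ...   | yes refl = inj₁ (x∈p∪q⁺ (inj₂ (x∈⁅x⁆ x)))
    ...   | no  x≢u  = inj₂ (inj₂ (inj₁ (x∈p∪q⁺ (inj₁ (x∈p∧x≢y⇒x∈p-y x∈U x≢u)))))

  invariant-step : ∀ {s s′} → LoopStep G s s′ → Inv s → Inv s′
  invariant-step (toZ u u∈U clique)    = invariant-toZ u∈U clique
  invariant-step (toT u u∈U nonClique) = invariant-toT u∈U nonClique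

  μ : State n → ℕ
  μ ⟨ _ , C , U , _ ⟩ = ∣ U ∪ C ∣

  μ-shrinks : u ∈ U → u ∉ C → (∀ {x} → x ∈ S → x ∈ U - u ⊎ x ∈ C) → ∣ S ∣ < ∣ U ∪ C ∣
  μ-shrinks {u} {U} u∈U u∉C S⊆ = p⊂q⇒∣p∣<∣q∣
    ( x∈p∪q⁺ ∘ Sum.map₁ (p─q⊆p U ⁅ u ⁆) ∘ S⊆
    , u , x∈p∪q⁺ (inj₁ u∈U) , [ (λ u∈ → x∈p─q⇒x∉q u∈ (x∈⁅x⁆ u)) , u∉C ]′ ∘ S⊆ )

  step-or-halt : ∀ s → Inv s → Empty (State.U s) ⊎ ∃ λ s′ → LoopStep G s s′ × μ s′ < μ s
  step-or-halt ⟨ T , C , U , Z ⟩ I with nonempty? U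
  ... | no U-empty = inj₁ U-empty
  ... | yes (u , u∈U) with isClique? (N G u ∩ C) | Invariant.U-disjoint-C I u∈U
  ...   | yes clique    | u∉C = inj₂ (_ , toZ u u∈U clique , μ-shrinks u∈U u∉C (x∈p∪q⁻ _ _))
  ...   | no  nonClique | u∉C = inj₂ (_ , toT u u∈U nonClique , μ-shrinks u∈U u∉C new⊆)
    where
    new⊆ : x ∈ ((U - u) ∪ (C ─ N G u)) ∪ (C ∩ N G u) → x ∈ U - u ⊎ x ∈ C
    new⊆ = [ [ inj₁ , inj₂ ∘ p─q⊆p C (N G u) ]′ ∘ x∈p∪q⁻ _ _ , inj₂ ∘ proj₁ ∘ x∈p∩q⁻ _ _ ]′
           ∘ x∈p∪q⁻ _ _

  invariant-final : Invariant T C U Z → Empty U → MaximalInteresting G T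
  invariant-final {T} {C} {U} {Z} I U-empty = (T-nonempty , T-coConnected , C[T]-nonClique) , maximal
    where
    open Invariant I

    C[T]-nonClique : ¬ IsClique G (InC G T)
    C[T]-nonClique = C-nonClique ∘ IsClique-mono (to C⇔InC)

    outside-T∪C∪U : z ∉ T → z ∉ C → z ∈ Z
    outside-T∪C∪U {z} z∉T z∉C with covers z
    ... | inj₁ z∈T               = contradiction z∈T z∉T
    ... | inj₂ (inj₁ z∈C)        = contradiction z∈C z∉C
    ... | inj₂ (inj₂ (inj₁ z∈U)) = contradiction (z , z∈U) U-empty
    ... | inj₂ (inj₂ (inj₂ z∈Z)) = z∈Z

    maximal : ∀ T′ → Interesting G T′ → T ⊆ T′ → T′ ⊆ T
    maximal T′ (_ , T′-coConnected , C[T′]-nonClique) T⊆T′ {x} x∈T′ with x ∈? T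
    ... | yes x∈T = x∈T
    ... | no  x∉T with T-nonempty
    ...   | t , t∈T with coWalk-leaves x∉T t∈T (T′-coConnected x t x∈T′ (T⊆T′ t∈T))
    ...     | z , z∈T′ , z∉T , w , w∈T , z≁w =
      contradiction (IsClique-mono C[T′]⊆N[z]∩C (Z-cliques z∈Z)) C[T′]-nonClique
      where
      z∈Z : z ∈ Z
      z∈Z = outside-T∪C∪U z∉T (λ z∈C → z≁w (proj₂ (to C⇔InC z∈C) w w∈T))

      C[T′]⊆N[z]∩C : InC G T′ y → y ∈ N G z ∩ C
      C[T′]⊆N[z]∩C y∈C[T′] = x∈p∩q⁺
        ( from ∈N⇔~ (~-sym (proj₂ y∈C[T′] z z∈T′))
        , from C⇔InC (InC-antitone T⊆T′ y∈C[T′]) )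

  run-exists : Σ (Result n) (Run G)
  run-exists with hasInducedP₃?
  ... | no noP₃ = unionOfCliques , runCliques (DUC⇒deg≡size∸1 (¬HasInducedP₃⇒DUC noP₃))
  ... | yes (x , t , y , x≢y , x≁y , x~t , t~y)
    with halts μ invariant-step step-or-halt (initState G t) (invariant-init x~t t~y x≢y x≁y)
  ...   | s , loop , halted =
    returnSet (State.T s) ,
    runLoop x _ y t s (componentSize x) (deg<size∸1 (componentSize x) (x~t ◅ t~y ◅ ε) x≢y x≁y)
            x≢y x≁y x~t t~y loop halted

  run-correct : ∀ r → Run G r → Correct G r
  run-correct _ (runCliques deg≡) = mk⇔ (λ _ → deg≡size∸1⇒DUC deg≡) (λ _ → refl) , λ _ ()
  run-correct _ (runLoop x _ y t s _ _ x≢y x≁y x~t t~y loop halted) =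
    mk⇔ (λ ()) (λ duc → contradiction (duc x y (x~t ◅ t~y ◅ ε) x≢y) x≁y) ,
    λ { _ refl → invariant-final (preserved invariant-step loop (invariant-init x~t t~y x≢y x≁y)) halted }

lemma7 : ∀ {n} (G : Graph n) →
    Σ (Result n) (Run G) × (∀ r → Run G r → Correct G r)
lemma7 G = run-exists G , run-correct G
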